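{- Every AT-free graph $G$ has bandwidth at most $3\Delta(G)$.
   Context: Graphs are finite, simple and undirected; $\Delta(G)$ is the maximum degree. An asteroidal triple in $G$ is an independent set of three vertices such that each pair of them is joined by a path avoiding the (closed) neighbourhood of the third. $G$ is AT-free if it contains no asteroidal triple. For a vertex ordering (total order) $(v_1,\dots,v_n)$ of $V(G)$, the width of an edge $v_iv_j$ is $|i-j|$ and the width of the ordering is the maximum width of an edge; the bandwidth of $G$ is the minimum width over all vertex orderings. -}

module Defs where

open import Data.Nat using (ℕ; zero; suc; _≤_; _⊔_; _+_)
open import Data.Nat.Properties using ()
open import Data.Fin using (Fin; toℕ)
open import Data.Bool using (Bool; true; false; T)
open import Data.List using (List; []; _∷_; filterᵇ; length; foldr; map)
open import Data.List.Relation.Unary.All using (All)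
open import Data.List.Base using (head; last)
open import Data.Maybe using (just)
open import Data.Product using (Σ; ∃; _×_; _,_)
open import Data.Sum using (_⊎_)
open import Data.Fin.Base using ()
open import Data.List.Base using (allFin)
open import Function.Bundles using (_↔_; Inverse)
open import Relation.Binary.PropositionalEquality using (_≡_)
open import Relation.Nullary using (¬_)

record Graph (n : ℕ) : Set where
  field
    adj     : Fin n → Fin n → Bool
    irrefl  : ∀ v → adj v v ≡ false
    sym     : ∀ u v → adj u v ≡ adj v u

open Graph public

Adj : ∀ {n} → Graph n → Fin n → Fin n → Set
Adj G u v = T (adj G u v)

degree : ∀ {n} → Graph n → Fin n → ℕ
degree {n} G v = length (filterᵇ (adj G v) (allFin n))

maxDegree : ∀ {n} → Graph n → ℕ
maxDegree {n} G = foldr _⊔_ 0 (map (degree G) (allFin n))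

InClosedNbhd : ∀ {n} → Graph n → Fin n → Fin n → Set
InClosedNbhd G z w = (w ≡ z) ⊎ Adj G z w

data Walk {n : ℕ} (G : Graph n) : List (Fin n) → Set where
  single : ∀ v → Walk G (v ∷ [])
  step   : ∀ u v vs → Adj G u v → Walk G (v ∷ vs) → Walk G (u ∷ v ∷ vs)

PathAvoiding : ∀ {n} → Graph n → Fin n → Fin n → Fin n → Set
PathAvoiding {n} G x y z =
  Σ (List (Fin n)) λ p →
    Walk G p × head p ≡ just x × last p ≡ just y ×
    All (λ w → ¬ InClosedNbhd G z w) p

Independent3 : ∀ {n} → Graph n → Fin n → Fin n → Fin n → Set
Independent3 G x y z =
  ¬ (x ≡ y) × ¬ (y ≡ z) × ¬ (x ≡ z) ×
  ¬ Adj G x y × ¬ Adj G y z × ¬ Adj G x z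

AsteroidalTriple : ∀ {n} → Graph n → Fin n → Fin n → Fin n → Set
AsteroidalTriple G x y z =
  Independent3 G x y z ×
  PathAvoiding G x y z × PathAvoiding G y z x × PathAvoiding G x z y

ATFree : ∀ {n} → Graph n → Set
ATFree G = ∀ x y z → ¬ AsteroidalTriple G x y z

-- a vertex ordering: bijection from vertices to positions (v ↦ its index)
Ordering : ℕ → Set
Ordering n = Fin n ↔ Fin n

dist : ℕ → ℕ → ℕ
dist zero j = j
dist (suc i) zero = suc i
dist (suc i) (suc j) = dist i j

WidthAtMost : ∀ {n} → Graph n → Ordering n → ℕ → Set
WidthAtMost G σ k =
  ∀ u v → Adj G u v → dist (toℕ (Inverse.to σ u)) (toℕ (Inverse.to σ v)) ≤ k

-- bandwidth(G) ≤ k  iff  some ordering has width ≤ k (bandwidth = min width)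
BandwidthAtMost : ∀ {n} → Graph n → ℕ → Set
BandwidthAtMost {n} G k = Σ (Ordering n) λ σ → WidthAtMost G σ k

{-# OPTIONS --safe #-}
-- In an AT-free graph each component has a dominating pair x, y: the closed neighbourhood of every
-- vertex of the component meets every x–y path. It is found by repeatedly replacing x or y by a vertex
-- z whose neighbourhood some x–y path avoids; AT-freeness guarantees that one of the two replacements
-- enlarges the components of G − N[y] around x and of G − N[x] around y, taken lexicographically.
-- Fix a shortest x–y path p₀ … p_d. Each vertex w meets it in an interval of indices [entry w, exit w]
-- of length at most 2, and for an edge uv AT-freeness forbids entry v > exit u + 2 (else u, p_{exit u + 1},
-- p_{exit u + 3} is an asteroidal triple). Listing each component by (entry, exit), every vertex between
-- the ends of an edge then lies in N[p_b] ∪ N[p_{b+1}] ∪ N[p_{b+2}] for one b, a set of at most 3Δ + 1 vertices.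
module Submission where

open import Data.Nat
  using ( ℕ; zero; suc; pred; _+_; _*_; _∸_; _⊔_; ∣_-_∣; _≤_; _<_; _≤′_; z≤n; s≤s; z<s; ≤′-refl; ≤′-step
        ; _<?_; _≡ᵇ_; _<ᵇ_; _≤ᵇ_ )
open import Data.Nat.Properties
  using ( ≤-refl; ≤-reflexive; ≤-trans; ≤-antisym; ≤-pred; ≤-<-connex; ≤⇒≤′; <-irrefl; <-trans; <-cmp
        ; <⇒≤; <⇒≱; <⇒≢; ≮⇒≥; n≤1+n; n<1+n; m≤n⇒m≤1+n; m<n⇒m<1+n; m≤n⇒m<n∨m≡n; m≤m+n; m≤n+m; m<n+m
        ; m≤m⊔n; m≤n⊔m; +-comm; +-suc; +-identityʳ; +-mono-≤; +-monoʳ-≤; +-monoˡ-≤; +-monoʳ-<; +-mono-≤-<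
        ; +-cancelˡ-≤; +-cancelˡ-≡; *-monoˡ-≤; +-∸-assoc; m∸n≤m; m∸[m∸n]≡n; n∸n≡0; m≤n⇒m∸n≡0; m≤n+o⇒m∸n≤o
        ; m≤n⇒∣m-n∣≡n∸m; ∣-∣-comm; <ᵇ⇒<; <⇒<ᵇ; ≤ᵇ⇒≤; ≤⇒≤ᵇ; ≡ᵇ⇒≡; ≡⇒≡ᵇ; module ≤-Reasoning )
open import Data.Fin using (Fin; zero; suc; toℕ; fromℕ<; _≟_)
open import Data.Fin.Properties
  using (any?; injective⇒≤; punchOut-injective; toℕ<n; toℕ-injective; toℕ-fromℕ<; fromℕ<-injective)
open import Data.Bool using (Bool; true; false; T; not; _∧_; _∨_; if_then_else_)
open import Data.Bool.Properties using (T-∧; T-∨)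
open import Data.Empty using (⊥-elim)
open import Data.Product using (Σ; ∃-syntax; _×_; _,_; proj₁; proj₂)
open import Data.Sum using (_⊎_; inj₁; inj₂; [_,_]′; map₂)
open import Data.List using (List; []; _∷_; filterᵇ; length; foldr; tabulate; head; last)
open import Data.List.Properties using (map-tabulate)
open import Data.List.Relation.Unary.All as All using (All; []; _∷_)
open import Data.List.Relation.Unary.All.Properties using (head⁺; last⁺)
open import Data.Maybe using (Maybe; just; nothing; fromMaybe)
import Data.Maybe as Maybe
open import Data.Maybe.Relation.Unary.All as MaybeAll using (drop-just)
open import Function using (_∘_; id; Equivalence; Inverse; Injective; _↔_; mk↔ₛ′)
open import Relation.Binary.Definitions using (tri<; tri≈; tri>)
open import Relation.Binary.PropositionalEquality using (_≡_; _≢_; refl; sym; trans; cong; subst; subst₂)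
open import Relation.Nullary using (¬_; ¬?; does; yes; no; _×-dec_)
open import Relation.Nullary.Decidable using (⌊_⌋; T?; toWitness; fromWitness; decidable-stable)
open import Defs hiding (sym)

open Equivalence using (to; from)

T-ext : ∀ {a b} → (T a → T b) → (T b → T a) → a ≡ b
T-ext {false} {false} _   _   = refl
T-ext {false} {true}  _   b⇒a = ⊥-elim (b⇒a _)
T-ext {true}  {false} a⇒b _   = ⊥-elim (a⇒b _)
T-ext {true}  {true}  _   _   = refl

T-not⁻ : ∀ {b} → T (not b) → ¬ T b
T-not⁻ {false} _ ()

T-not⁺ : ∀ {b} → ¬ T b → T (not b)
T-not⁺ {false} _  = _
T-not⁺ {true}  ¬b = ¬b _

≟⇒≡ : ∀ {n} {v w : Fin n} → T (does (v ≟ w)) → v ≡ w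
≟⇒≡ {v = v} {w} with v ≟ w
... | yes v≡w = λ _ → v≡w

≡⇒≟ : ∀ {n} {v w : Fin n} → v ≡ w → T (does (v ≟ w))
≡⇒≟ {v = v} {w} v≡w with v ≟ w
... | yes _   = _
... | no  v≢w = v≢w v≡w

infix 4 _⊆_
_⊆_ : ∀ {n} → (f g : Fin n → Bool) → Set
f ⊆ g = ∀ {v} → T (f v) → T (g v)

∃ᵇ : ∀ {n} → (Fin n → Bool) → Bool
∃ᵇ f = ⌊ any? (T? ∘ f) ⌋

∃ᵇ-elim : ∀ {n} (f : Fin n → Bool) → T (∃ᵇ f) → ∃[ v ] T (f v)
∃ᵇ-elim f = toWitness {a? = any? (T? ∘ f)}

∃ᵇ-intro : ∀ {n} (f : Fin n → Bool) {v} → T (f v) → T (∃ᵇ f)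
∃ᵇ-intro f {v} fv = fromWitness {a? = any? (T? ∘ f)} (v , fv)

⊆-dec : ∀ {n} (f g : Fin n → Bool) → f ⊆ g ⊎ ∃[ v ] T (f v) × ¬ T (g v)
⊆-dec f g with any? (λ v → T? (f v) ×-dec ¬? (T? (g v)))
... | yes escape = inj₂ escape
... | no  none   = inj₁ λ {v} fv → decidable-stable (T? (g v)) (λ ¬gv → none (v , fv , ¬gv))

count : ∀ {n} → (Fin n → Bool) → ℕ
count {zero}  f = 0
count {suc n} f = if f zero then suc (count (f ∘ suc)) else count (f ∘ suc)

count≤n : ∀ {n} (f : Fin n → Bool) → count f ≤ n
count≤n {zero}  f = z≤n
count≤n {suc n} f with f zero
... | true  = s≤s (count≤n (f ∘ suc))
... | false = m≤n⇒m≤1+n (count≤n (f ∘ suc))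

count-mono : ∀ {n} {f g : Fin n → Bool} → f ⊆ g → count f ≤ count g
count-mono {zero}          f⊆g = z≤n
count-mono {suc n} {f} {g} f⊆g with f zero | g zero | f⊆g {zero}
... | true  | true  | _   = s≤s (count-mono (λ {v} → f⊆g {suc v}))
... | true  | false | f⇒g = ⊥-elim (f⇒g _)
... | false | true  | _   = m≤n⇒m≤1+n (count-mono (λ {v} → f⊆g {suc v}))
... | false | false | _   = count-mono (λ {v} → f⊆g {suc v})

count-mono-< : ∀ {n} {f g : Fin n → Bool} → f ⊆ g → ∀ w → T (g w) → ¬ T (f w) → count f < count g
count-mono-< {suc n} {f} {g} f⊆g zero gw ¬fw with f zero | g zero | f⊆g {zero}
... | true  | _     | _ = ⊥-elim (¬fw _)
... | false | true  | _ = s≤s (count-mono (λ {v} → f⊆g {suc v}))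
count-mono-< {suc n} {f} {g} f⊆g (suc w) gw ¬fw with f zero | g zero | f⊆g {zero}
... | true  | true  | _   = s≤s (count-mono-< (λ {v} → f⊆g {suc v}) w gw ¬fw)
... | true  | false | f⇒g = ⊥-elim (f⇒g _)
... | false | true  | _   = m≤n⇒m≤1+n (count-mono-< (λ {v} → f⊆g {suc v}) w gw ¬fw)
... | false | false | _   = count-mono-< (λ {v} → f⊆g {suc v}) w gw ¬fw

count-∨ : ∀ {n} (f g : Fin n → Bool) → count (λ v → f v ∨ g v) ≤ count f + count g
count-∨ {zero}  f g = z≤n
count-∨ {suc n} f g with f zero | g zero
... | true  | true  = s≤s (≤-trans (count-∨ (f ∘ suc) (g ∘ suc)) (+-monoʳ-≤ (count (f ∘ suc)) (n≤1+n _)))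
... | true  | false = s≤s (count-∨ (f ∘ suc) (g ∘ suc))
... | false | true  = ≤-trans (s≤s (count-∨ (f ∘ suc) (g ∘ suc))) (≤-reflexive (sym (+-suc _ _)))
... | false | false = count-∨ (f ∘ suc) (g ∘ suc)

count-insert : ∀ {n} (c : Fin n) (f : Fin n → Bool) → count (λ v → does (v ≟ c) ∨ f v) ≤ suc (count f)
count-insert {suc n} zero f with f zero
... | true  = s≤s (n≤1+n _)
... | false = ≤-refl
count-insert {suc n} (suc c) f with f zero
... | true  = s≤s (count-insert c (f ∘ suc))
... | false = count-insert c (f ∘ suc)

search : ∀ {n} → (Fin n → Bool) → Maybe (Fin n)
search {zero}  f = nothing
search {suc n} f = if f zero then just zero else Maybe.map suc (search (f ∘ suc))

search-cong : ∀ {n} {f g : Fin n → Bool} → (∀ v → f v ≡ g v) → search f ≡ search g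
search-cong {zero}          f≗g = refl
search-cong {suc n} {f} {g} f≗g rewrite f≗g zero | search-cong {f = f ∘ suc} {g ∘ suc} (f≗g ∘ suc) = refl

search-complete : ∀ {n} (f : Fin n → Bool) w → T (f w) → ∃[ i ] search f ≡ just i × T (f i)
search-complete {suc n} f w fw with f zero in eq
... | true = zero , refl , subst T (sym eq) _
search-complete {suc n} f zero    fw | false = ⊥-elim (subst T eq fw)
search-complete {suc n} f (suc w) fw | false with search-complete (f ∘ suc) w fw
... | i , eq′ , fi rewrite eq′ = suc i , refl , fi

choose : ∀ {n} → (Fin n → Bool) → Fin n → Fin n
choose f default = fromMaybe default (search f)

choose-cong : ∀ {n} {f g : Fin n → Bool} {d d′ w} → (∀ v → f v ≡ g v) → T (f w) → choose f d ≡ choose g d′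
choose-cong {f = f} {g} {d} {d′} {w} f≗g fw with search-complete f w fw
... | i , search-f≡i , _ =
  trans (cong (fromMaybe d) search-f≡i) (sym (cong (fromMaybe d′) (trans (sym (search-cong f≗g)) search-f≡i)))

choose-satisfies : ∀ {n} (f : Fin n → Bool) {default w} → T (f w) → T (f (choose f default))
choose-satisfies f {w = w} fw with search-complete f w fw
... | i , search≡i , fi rewrite search≡i = fi

least : (ℕ → Bool) → ℕ → ℕ
least f zero    = 0
least f (suc b) = if f 0 then 0 else suc (least (f ∘ suc) b)

least≤bound : ∀ (f : ℕ → Bool) b → least f b ≤ b
least≤bound f zero = z≤n
least≤bound f (suc b) with f 0
... | true  = z≤n
... | false = s≤s (least≤bound (f ∘ suc) b)

least-satisfies : ∀ (f : ℕ → Bool) b {j} → j ≤ b → T (f j) → T (f (least f b))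
least-satisfies f zero    z≤n fj = fj
least-satisfies f (suc b) {j} j≤b fj with f 0 in f0
... | true = subst T (sym f0) _
least-satisfies f (suc b) {zero}  _         fj | false = ⊥-elim (subst T f0 fj)
least-satisfies f (suc b) {suc j} (s≤s j≤b) fj | false = least-satisfies (f ∘ suc) b j≤b fj

least-minimal : ∀ (f : ℕ → Bool) b {j} → j < least f b → ¬ T (f j)
least-minimal f (suc b) {j} j<least with f 0 in f0
least-minimal f (suc b) {zero}  _             | false = λ fj → subst T f0 fj
least-minimal f (suc b) {suc j} (s≤s j<least) | false = least-minimal (f ∘ suc) b j<least

least≤ : ∀ (f : ℕ → Bool) b {j} → T (f j) → least f b ≤ j
least≤ f b fj = ≮⇒≥ (λ j<least → least-minimal f b j<least fj)

greatest : (ℕ → Bool) → ℕ → ℕ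
greatest f zero    = 0
greatest f (suc b) = if f (suc b) then suc b else greatest f b

greatest≤bound : ∀ (f : ℕ → Bool) b → greatest f b ≤ b
greatest≤bound f zero = z≤n
greatest≤bound f (suc b) with f (suc b)
... | true  = ≤-refl
... | false = m≤n⇒m≤1+n (greatest≤bound f b)

greatest-satisfies : ∀ (f : ℕ → Bool) b {j} → j ≤ b → T (f j) → T (f (greatest f b))
greatest-satisfies f zero    z≤n fj = fj
greatest-satisfies f (suc b) {j} j≤b fj with f (suc b) in fb | m≤n⇒m<n∨m≡n j≤b
... | true  | _            = subst T (sym fb) _
... | false | inj₁ j<b     = greatest-satisfies f b (≤-pred j<b) fj
... | false | inj₂ refl    = ⊥-elim (subst T fb fj)

greatest-maximal : ∀ (f : ℕ → Bool) b {j} → greatest f b < j → j ≤ b → ¬ T (f j)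
greatest-maximal f zero    (s≤s _) ()
greatest-maximal f (suc b) {j} g<j j≤b with f (suc b) in fb | m≤n⇒m<n∨m≡n j≤b
... | true  | _         = ⊥-elim (<⇒≱ g<j j≤b)
... | false | inj₁ j<b  = greatest-maximal f b g<j (≤-pred j<b)
... | false | inj₂ refl = λ fj → subst T fb fj

module Saturation {n : ℕ} (Φ : (Fin n → Bool) → Fin n → Bool)
                  (Φ-inflationary : ∀ f → f ⊆ Φ f)
                  (Φ-monotone : ∀ {f g} → f ⊆ g → Φ f ⊆ Φ g)
                  (start : Fin n → Bool) where

  stage : ℕ → Fin n → Bool
  stage zero    = start
  stage (suc k) = Φ (stage k)

  stage-mono : ∀ {j k} → j ≤ k → stage j ⊆ stage k
  stage-mono = go ∘ ≤⇒≤′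
    where
      go : ∀ {j k} → j ≤′ k → stage j ⊆ stage k
      go ≤′-refl        = id
      go {k = suc k} (≤′-step j≤′k) = Φ-inflationary (stage k) ∘ go j≤′k

  stage⊆stable : ∀ {j} → Φ (stage j) ⊆ stage j → ∀ k → stage k ⊆ stage j
  stage⊆stable {j} stable zero    = stage-mono {0} {j} z≤n
  stage⊆stable {j} stable (suc k) = stable ∘ Φ-monotone (stage⊆stable {j} stable k)

  -- Until it stabilises, every stage adds a vertex; there is room for at most n of them.
  stable-or-growing : ∀ k → (∃[ j ] j < k × Φ (stage j) ⊆ stage j) ⊎ k ≤ count (stage k)
  stable-or-growing zero = inj₂ z≤n
  stable-or-growing (suc k) with stable-or-growing k
  ... | inj₁ (j , j<k , stable) = inj₁ (j , m<n⇒m<1+n j<k , stable)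
  ... | inj₂ k≤count with ⊆-dec (Φ (stage k)) (stage k)
  ...   | inj₁ stable            = inj₁ (k , n<1+n k , stable)
  ...   | inj₂ (v , new , ¬old) = inj₂ (≤-trans (s≤s k≤count) (count-mono-< (Φ-inflationary _) v new ¬old))

  stage⊆stage-n : ∀ k → stage k ⊆ stage n
  stage⊆stage-n k with stable-or-growing (suc n)
  ... | inj₁ (j , j≤n , stable) = stage-mono (≤-pred j≤n) ∘ stage⊆stable {j} stable k
  ... | inj₂ n<count          = ⊥-elim (<⇒≱ n<count (count≤n (stage (suc n))))

-- A value missed by f would let punchOut inject Fin (suc m) into Fin m.
injective⇒surjective : ∀ {m} {f : Fin m → Fin m} → Injective _≡_ _≡_ f → ∀ j → ∃[ i ] f i ≡ j
injective⇒surjective {suc m} {f} f-inj j with any? (λ i → f i ≟ j)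
... | yes hit  = hit
... | no  miss = ⊥-elim (<-irrefl refl (injective⇒≤ (f-inj ∘ punchOut-injective (missed _) (missed _))))
  where
    missed : ∀ i → j ≢ f i
    missed i j≡fi = miss (i , sym j≡fi)

injective⇒↔ : ∀ {m} {f : Fin m → Fin m} → Injective _≡_ _≡_ f → Fin m ↔ Fin m
injective⇒↔ {f = f} f-inj =
  mk↔ₛ′ f (proj₁ ∘ surj) (proj₂ ∘ surj) (λ i → f-inj (proj₂ (surj (f i))))
  where
    surj : ∀ j → ∃[ i ] f i ≡ j
    surj = injective⇒surjective f-inj

length-filter-tabulate : ∀ {m} {A : Set} (f : A → Bool) (g : Fin m → A) →
                         length (filterᵇ f (tabulate g)) ≡ count (f ∘ g)
length-filter-tabulate {zero}  f g = refl
length-filter-tabulate {suc m} f g with f (g zero)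
... | true  = cong suc (length-filter-tabulate f (g ∘ suc))
... | false = length-filter-tabulate f (g ∘ suc)

≤-foldr-⊔-tabulate : ∀ {m} (h : Fin m → ℕ) i → h i ≤ foldr _⊔_ 0 (tabulate h)
≤-foldr-⊔-tabulate h zero    = m≤m⊔n _ _
≤-foldr-⊔-tabulate h (suc i) = ≤-trans (≤-foldr-⊔-tabulate (h ∘ suc) i) (m≤n⊔m _ _)

count-adj≤maxDegree : ∀ {n} (G : Graph n) v → count (adj G v) ≤ maxDegree G
count-adj≤maxDegree G v =
  subst₂ _≤_ (length-filter-tabulate (adj G v) id) (cong (foldr _⊔_ 0) (sym (map-tabulate id (degree G))))
         (≤-foldr-⊔-tabulate (degree G) v)

dist≡∣-∣ : ∀ a b → dist a b ≡ ∣ a - b ∣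
dist≡∣-∣ zero    b       = refl
dist≡∣-∣ (suc a) zero    = refl
dist≡∣-∣ (suc a) (suc b) = dist≡∣-∣ a b

dist-comm : ∀ a b → dist a b ≡ dist b a
dist-comm a b = trans (dist≡∣-∣ a b) (trans (∣-∣-comm a b) (sym (dist≡∣-∣ b a)))

dist≤ : ∀ {a b k} → a ≤ b → b ≤ a + k → dist a b ≤ k
dist≤ {a} {b} a≤b b≤a+k =
  subst (_≤ _) (sym (trans (dist≡∣-∣ a b) (m≤n⇒∣m-n∣≡n∸m a≤b))) (m≤n+o⇒m∸n≤o b a b≤a+k)

within-two : ∀ {b j} → b ≤ j → j ≤ 2 + b → j ≡ b ⊎ j ≡ 1 + b ⊎ j ≡ 2 + b
within-two {b} {j} b≤j j≤2+b with m≤n⇒m<n∨m≡n b≤j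
... | inj₂ b≡j = inj₁ (sym b≡j)
... | inj₁ b<j with m≤n⇒m<n∨m≡n b<j
...   | inj₂ 1+b≡j = inj₂ (inj₁ (sym 1+b≡j))
...   | inj₁ 1+b<j = inj₂ (inj₂ (≤-antisym j≤2+b 1+b<j))

n<m⇒m∸n≡1+m∸1+n : ∀ {m n} → n < m → m ∸ n ≡ suc (m ∸ suc n)
n<m⇒m∸n≡1+m∸1+n = +-∸-assoc 1

m<n+1+o⇒n<p⇒m<p+o : ∀ {m n o p} → m < n + suc o → n < p → m < p + o
m<n+1+o⇒n<p⇒m<p+o {n = n} {o} m<n+1+o n<p = ≤-trans m<n+1+o (≤-trans (≤-reflexive (+-suc n o)) (+-monoˡ-≤ o n<p))

module Digits (B : ℕ) where

  infixl 6 _⊕_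

  -- Abstract, so that unification sees a ⊕ b as a pair of digits rather than unfolding it.
  abstract
    _⊕_ : ℕ → ℕ → ℕ
    a ⊕ b = a * B + b

    ⊕-<ˡ : ∀ {a a′} b {b′} → a < a′ → b < B → a ⊕ b < a′ ⊕ b′
    ⊕-<ˡ {a} {a′} b {b′} a<a′ b<B = begin-strict
      a * B + b  <⟨ +-monoʳ-< (a * B) b<B ⟩
      a * B + B  ≡⟨ +-comm (a * B) B ⟩
      suc a * B  ≤⟨ *-monoˡ-≤ B a<a′ ⟩
      a′ * B     ≤⟨ m≤m+n (a′ * B) b′ ⟩
      a′ * B + b′ ∎
      where open ≤-Reasoning

    ⊕-mono-≤ : ∀ {a a′ b b′} → a ≤ a′ → b ≤ b′ → a ⊕ b ≤ a′ ⊕ b′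
    ⊕-mono-≤ a≤a′ b≤b′ = +-mono-≤ (*-monoˡ-≤ B a≤a′) b≤b′

    ⊕-<ʳ : ∀ {a a′ b b′} → a ≤ a′ → b < b′ → a ⊕ b < a′ ⊕ b′
    ⊕-<ʳ a≤a′ b<b′ = +-mono-≤-< (*-monoˡ-≤ B a≤a′) b<b′

    ⊕-≤⇒≤ˡ : ∀ {a a′ b b′} → b′ < B → a ⊕ b ≤ a′ ⊕ b′ → a ≤ a′
    ⊕-≤⇒≤ˡ b′<B ⊕≤ = ≮⇒≥ (λ a′<a → <⇒≱ (⊕-<ˡ _ a′<a b′<B) ⊕≤)

    ⊕-≤⇒≤ʳ : ∀ {a b b′} → a ⊕ b ≤ a ⊕ b′ → b ≤ b′
    ⊕-≤⇒≤ʳ {a} = +-cancelˡ-≤ (a * B) _ _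

    ⊕-injectiveʳ : ∀ {a a′ b b′} → b < B → b′ < B → a ⊕ b ≡ a′ ⊕ b′ → b ≡ b′
    ⊕-injectiveʳ {a} {a′} {b} {b′} b<B b′<B eq =
      +-cancelˡ-≡ (a′ * B) _ _ (subst (λ x → x ⊕ b ≡ a′ ⊕ b′) a≡a′ eq)
      where
        a≡a′ : a ≡ a′
        a≡a′ = ≤-antisym (⊕-≤⇒≤ˡ b′<B (≤-reflexive eq)) (⊕-≤⇒≤ˡ b<B (≤-reflexive (sym eq)))

module Ranking {n : ℕ} (key : Fin n → ℕ) (key-injective : ∀ {u v} → key u ≡ key v → u ≡ v) where

  rank : Fin n → ℕ
  rank w = count (λ u → key u <ᵇ key w)

  rank<n : ∀ w → rank w < n
  rank<n w = ≤-trans (count-mono-< {g = λ _ → true} _ w _ (<-irrefl refl ∘ <ᵇ⇒< (key w) (key w))) (count≤n _)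

  rank-mono-< : ∀ {u v} → key u < key v → rank u < rank v
  rank-mono-< {u} {v} ku<kv =
    count-mono-< (λ {w} kw<ku → <⇒<ᵇ (<-trans (<ᵇ⇒< (key w) (key u) kw<ku) ku<kv)) u (<⇒<ᵇ ku<kv)
                 (<-irrefl refl ∘ <ᵇ⇒< (key u) (key u))

  rank-injective : ∀ {u v} → rank u ≡ rank v → u ≡ v
  rank-injective {u} {v} ru≡rv with <-cmp (key u) (key v)
  ... | tri< ku<kv _ _ = ⊥-elim (<⇒≢ (rank-mono-< ku<kv) ru≡rv)
  ... | tri≈ _ ku≡kv _ = key-injective ku≡kv
  ... | tri> _ _ kv<ku = ⊥-elim (<⇒≢ (rank-mono-< kv<ku) (sym ru≡rv))

  ordering : Fin n ↔ Fin n
  ordering = injective⇒↔ {f = λ w → fromℕ< (rank<n w)}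
                         (rank-injective ∘ fromℕ<-injective _ _ (rank<n _) (rank<n _))

  toℕ-ordering : ∀ w → toℕ (Inverse.to ordering w) ≡ rank w
  toℕ-ordering w = toℕ-fromℕ< (rank<n w)

  between : Fin n → Fin n → Fin n → Bool
  between u v w = (key u ≤ᵇ key w) ∧ (key w <ᵇ key v)

  rank-gap : ∀ {u v} → key u < key v → rank v ≤ rank u + count (between u v)
  rank-gap {u} {v} ku<kv = ≤-trans (count-mono {f = λ w → key w <ᵇ key v} (λ {w} → split {w}))
                                   (count-∨ (λ w → key w <ᵇ key u) (between u v))
    where
      split : ∀ {w} → T (key w <ᵇ key v) → T ((key w <ᵇ key u) ∨ between u v w)
      split {w} kw<kv with key w <? key u
      ... | yes kw<ku = from (T-∨ {key w <ᵇ key u}) (inj₁ (<⇒<ᵇ kw<ku))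
      ... | no  kw≮ku = from (T-∨ {key w <ᵇ key u}) (inj₂ (from T-∧ (≤⇒≤ᵇ (≮⇒≥ kw≮ku) , kw<kv)))

  ranks-close-< : ∀ {k u v} → key u < key v → count (between u v) ≤ k → dist (rank u) (rank v) ≤ k
  ranks-close-< {u = u} ku<kv gap≤k =
    dist≤ (<⇒≤ (rank-mono-< ku<kv)) (≤-trans (rank-gap ku<kv) (+-monoʳ-≤ (rank u) gap≤k))

  ranks-close : ∀ {k u v} → u ≢ v → (key u < key v → count (between u v) ≤ k) →
                (key v < key u → count (between v u) ≤ k) → dist (rank u) (rank v) ≤ k
  ranks-close {u = u} {v} u≢v uv vu with <-cmp (key u) (key v)
  ... | tri< ku<kv _ _ = ranks-close-< ku<kv (uv ku<kv)
  ... | tri≈ _ ku≡kv _ = ⊥-elim (u≢v (key-injective ku≡kv))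
  ... | tri> _ _ kv<ku = subst (_≤ _) (dist-comm (rank v) (rank u)) (ranks-close-< kv<ku (vu kv<ku))

PathAvoiding⇒ends-avoid : ∀ {n} {G : Graph n} {x y z} → PathAvoiding G x y z →
                          ¬ InClosedNbhd G z x × ¬ InClosedNbhd G z y
PathAvoiding⇒ends-avoid (_ , _ , head≡x , last≡y , avoid) =
  drop-just (subst (MaybeAll.All _) head≡x (head⁺ avoid)) , drop-just (subst (MaybeAll.All _) last≡y (last⁺ avoid))

-- Independence of the triple comes for free: each path keeps its ends out of the third closed neighbourhood.
asteroidal : ∀ {n} {G : Graph n} {x y z} →
             PathAvoiding G x y z → PathAvoiding G y z x → PathAvoiding G x z y → AsteroidalTriple G x y z
asteroidal xy-z yz-x xz-y with PathAvoiding⇒ends-avoid yz-x | PathAvoiding⇒ends-avoid xz-y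
... | y∉N[x] , z∉N[x] | _ , z∉N[y] =
  ( (y∉N[x] ∘ inj₁ ∘ sym) , (z∉N[y] ∘ inj₁ ∘ sym) , (z∉N[x] ∘ inj₁ ∘ sym)
  , (y∉N[x] ∘ inj₂) , (z∉N[y] ∘ inj₂) , (z∉N[x] ∘ inj₂) )
  , xy-z , yz-x , xz-y

module Reachability {n : ℕ} (G : Graph n) where

  Adj-sym : ∀ {u v} → Adj G u v → Adj G v u
  Adj-sym {u} {v} = subst T (Graph.sym G u v)

  Adj-irrefl : ∀ {v} → ¬ Adj G v v
  Adj-irrefl {v} = subst T (Graph.irrefl G v)

  N[_] : Fin n → Fin n → Bool
  N[ z ] w = does (w ≟ z) ∨ adj G z w

  N[]-sound : ∀ {z w} → T (N[ z ] w) → InClosedNbhd G z w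
  N[]-sound {z} {w} h with w ≟ z
  ... | yes w≡z = inj₁ w≡z
  ... | no  _   = inj₂ h

  N[]-complete : ∀ {z w} → InClosedNbhd G z w → T (N[ z ] w)
  N[]-complete {z} {w} c with w ≟ z | c
  ... | yes _   | _        = _
  ... | no  w≢z | inj₁ w≡z = ⊥-elim (w≢z w≡z)
  ... | no  _   | inj₂ z~w = z~w

  N[]-refl : ∀ {z} → T (N[ z ] z)
  N[]-refl = N[]-complete (inj₁ refl)

  N[]-adj : ∀ {z w} → Adj G z w → T (N[ z ] w)
  N[]-adj = N[]-complete ∘ inj₂

  N[]-sym : ∀ {z w} → T (N[ z ] w) → T (N[ w ] z)
  N[]-sym h with N[]-sound h
  ... | inj₁ refl = N[]-refl
  ... | inj₂ z~w  = N[]-adj (Adj-sym z~w)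

  N[]⇒Adj : ∀ {z w} → T (N[ z ] w) → w ≢ z → Adj G z w
  N[]⇒Adj hit w≢z = [ ⊥-elim ∘ w≢z , id ]′ (N[]-sound hit)

  N[]-shift : ∀ {a b w} → T (N[ a ] b) → T (N[ b ] w) → T (N[ a ] w) ⊎ Adj G b w
  N[]-shift ab bw with N[]-sound bw
  ... | inj₁ refl = inj₁ ab
  ... | inj₂ b~w  = inj₂ b~w

  path₃ : ∀ {a b c z} → Adj G a b → Adj G b c →
          ¬ T (N[ z ] a) → ¬ T (N[ z ] b) → ¬ T (N[ z ] c) → PathAvoiding G a c z
  path₃ a~b b~c a∉ b∉ c∉ =
    (_ ∷ _ ∷ _ ∷ []) , step _ _ _ a~b (step _ _ _ b~c (single _)) , refl , refl ,
    (a∉ ∘ N[]-complete) ∷ (b∉ ∘ N[]-complete) ∷ (c∉ ∘ N[]-complete) ∷ []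

  count-N[]≤ : ∀ z → count N[ z ] ≤ suc (maxDegree G)
  count-N[]≤ z = ≤-trans (count-insert z (adj G z)) (s≤s (count-adj≤maxDegree G z))

  expand : (A f : Fin n → Bool) → Fin n → Bool
  expand A f v = f v ∨ (A v ∧ ∃ᵇ (λ u → f u ∧ adj G u v))

  expand-intro : ∀ {A f u v} → T (f u) → T (A v) → Adj G u v → T (expand A f v)
  expand-intro {A} {f} {u} {v} fu av u~v =
    from (T-∨ {f v}) (inj₂ (from T-∧ (av , ∃ᵇ-intro (λ u → f u ∧ adj G u v) (from T-∧ (fu , u~v)))))

  expand-elim : ∀ {A f v} → T (expand A f v) → T (f v) ⊎ T (A v) × ∃[ u ] T (f u) × Adj G u v
  expand-elim {A} {f} {v} h with to (T-∨ {f v}) h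
  ... | inj₁ fv    = inj₁ fv
  ... | inj₂ new with to (T-∧ {A v}) new
  ...   | av , ∃u with ∃ᵇ-elim (λ u → f u ∧ adj G u v) ∃u
  ...     | u , fu∧u~v = inj₂ (av , u , to (T-∧ {f u}) fu∧u~v)

  expand-inflationary : ∀ A f → f ⊆ expand A f
  expand-inflationary A f {v} = from (T-∨ {f v}) ∘ inj₁

  expand-monotone : ∀ A {f g} → f ⊆ g → expand A f ⊆ expand A g
  expand-monotone A {f} {g} f⊆g h with expand-elim {A} {f} h
  ... | inj₁ fv                  = expand-inflationary A g (f⊆g fv)
  ... | inj₂ (av , u , fu , u~v) = expand-intro {A} {g} (f⊆g fu) av u~v

  module _ (A : Fin n → Bool) (s : Fin n) where

    open Saturation (expand A) (expand-inflationary A) (expand-monotone A) (λ v → A s ∧ does (v ≟ s))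
      renaming (stage to reach; stage⊆stage-n to reach⊆reachable)
      using ()
      public

    reachable : Fin n → Bool
    reachable = reach n

    reach-zero : ∀ {v} → T (reach 0 v) → T (A s) × v ≡ s
    reach-zero {v} h with to (T-∧ {A s}) h
    ... | as , v≟s = as , ≟⇒≡ v≟s

    reach-parent : ∀ k {v} → T (reach (suc k) v) → ¬ T (reach k v) → ∃[ u ] T (reach k u) × Adj G u v
    reach-parent k h ¬old with expand-elim {A} {reach k} h
    ... | inj₁ old                 = ⊥-elim (¬old old)
    ... | inj₂ (_ , u , ru , u~v) = u , ru , u~v

    reachable-step : ∀ {u v} → T (reachable u) → T (A v) → Adj G u v → T (reachable v)
    reachable-step ru av u~v = reach⊆reachable (suc n) (expand-intro {A} {reach n} ru av u~v)

    reachable-refl : T (A s) → T (reachable s)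
    reachable-refl as = reach⊆reachable 0 (from T-∧ (as , ≡⇒≟ {v = s} refl))

    reachable-ind : (P : Fin n → Set) → (T (A s) → P s) →
                    (∀ {u v} → T (reachable u) → T (A v) → Adj G u v → P u → P v) →
                    ∀ {v} → T (reachable v) → P v
    reachable-ind P base grow = go n
      where
        go : ∀ k {v} → T (reach k v) → P v
        go zero {v} h with reach-zero {v} h
        ... | as , refl = base as
        go (suc k) h with expand-elim {A} {reach k} h
        ... | inj₁ old                  = go k old
        ... | inj₂ (av , u , ru , u~v) = grow (reach⊆reachable k ru) av u~v (go k ru)

    reachable⊆A : ∀ {v} → T (reachable v) → T (A v)
    reachable⊆A = reachable-ind (T ∘ A) id (λ _ av _ _ → av)

    reachable⇒source∈A : ∀ {v} → T (reachable v) → T (A s)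
    reachable⇒source∈A = reachable-ind (λ _ → T (A s)) id (λ _ _ _ as → as)

  reachable-trans : ∀ {A s u v} → T (reachable A s u) → T (reachable A u v) → T (reachable A s v)
  reachable-trans {A} {s} {u} su =
    reachable-ind A u (T ∘ reachable A s) (λ _ → su) (λ _ av u~v su′ → reachable-step A s su′ av u~v)

  reachable-sym : ∀ {A s v} → T (reachable A s v) → T (reachable A v s)
  reachable-sym {A} {s} = reachable-ind A s (λ v → T (reachable A v s)) (reachable-refl A s) back
    where
      back : ∀ {u v} → T (reachable A s u) → T (A v) → Adj G u v → T (reachable A u s) → T (reachable A v s)
      back su av u~v us = reachable-trans (reachable-step A _ (reachable-refl A _ av) (reachable⊆A A s su) (Adj-sym u~v)) us

  WalkIn : (A : Fin n → Bool) → Fin n → Fin n → Set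
  WalkIn A u v = Σ (List (Fin n)) λ p → Walk G p × head p ≡ just u × last p ≡ just v × All (T ∘ A) p

  reachable⇒walk : ∀ {A s v} → T (reachable A s v) → WalkIn A s v
  reachable⇒walk {A} {s} = backwards ∘ reachable-sym
    where
      backwards : ∀ {v} → T (reachable A v s) → WalkIn A s v
      backwards {v} = reachable-ind A v (λ u → WalkIn A u v) (λ av → (v ∷ []) , single v , refl , refl , av ∷ [])
        (λ { _ au′ u~u′ ((_ ∷ p) , walk , refl , last≡v , all) →
               (_ ∷ _ ∷ p) , step _ _ p (Adj-sym u~u′) walk , refl , last≡v , au′ ∷ all })

  component : Fin n → Fin n → Bool
  component = reachable (λ _ → true)

  component-refl : ∀ {s} → T (component s s)
  component-refl {s} = reachable-refl _ s _

  component-step : ∀ {s u v} → T (component s u) → Adj G u v → T (component s v)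
  component-step {s} su = reachable-step _ s su _

module Domination {n : ℕ} (G : Graph n) (atf : ATFree G) where
  open Reachability G
  open Digits (suc n)

  -- C[ z ] x is the component of G − N[z] containing x (empty if x ∈ N[z]), written Cᶻ(x) in the literature.
  C[_] : Fin n → Fin n → Fin n → Bool
  C[ z ] = reachable (λ w → not (N[ z ] w))

  C⇒PathAvoiding : ∀ {x y z} → T (C[ z ] x y) → PathAvoiding G x y z
  C⇒PathAvoiding c with reachable⇒walk c
  ... | p , walk , head≡x , last≡y , avoid =
    p , walk , head≡x , last≡y , All.map (λ w∉N[z] → T-not⁻ w∉N[z] ∘ N[]-complete) avoid

  ¬asteroidal : ∀ {x y z} → T (C[ z ] x y) → T (C[ y ] x z) → ¬ T (C[ x ] y z)
  ¬asteroidal {x} {y} {z} xy xz yz =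
    atf x y z (asteroidal (C⇒PathAvoiding xy) (C⇒PathAvoiding yz) (C⇒PathAvoiding xz))

  C-⊆ : ∀ {x y z} → T (C[ y ] x z) → C[ y ] x ⊆ C[ y ] z
  C-⊆ xz = reachable-trans (reachable-sym xz)

  -- If N[b] does not separate a from z, a path from a avoiding N[b] can never enter N[z].
  C-⊂ : ∀ {a b z} → T (C[ z ] a b) → ¬ T (C[ b ] a z) → count (C[ b ] a) < count (C[ z ] a)
  C-⊂ {a} {b} {z} ab ¬az = count-mono-< C[b]⊆C[z] b ab (λ ab′ → T-not⁻ (reachable⊆A _ a ab′) N[]-refl)
    where
      avoid : Fin n → Fin n → Bool
      avoid z w = not (N[ z ] w)
      z∉N[b] : ¬ T (N[ b ] z)
      z∉N[b] = T-not⁻ (reachable⊆A (avoid z) a ab) ∘ N[]-sym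
      grow : ∀ {u v} → T (C[ b ] a u) → T (avoid b v) → Adj G u v → T (C[ z ] a u) → T (C[ z ] a v)
      grow {v = v} au v∉N[b] u~v zu = reachable-step (avoid z) a zu (T-not⁺ v∉N[z]) u~v
        where
          av : T (C[ b ] a v)
          av = reachable-step (avoid b) a au v∉N[b] u~v
          v∉N[z] : ¬ T (N[ z ] v)
          v∉N[z] h with N[]-sound h
          ... | inj₁ refl = ¬az av
          ... | inj₂ z~v  = ¬az (reachable-step (avoid b) a av (T-not⁺ z∉N[b]) (Adj-sym z~v))
      C[b]⊆C[z] : C[ b ] a ⊆ C[ z ] a
      C[b]⊆C[z] = reachable-ind (avoid b) a (T ∘ C[ z ] a)
                    (λ _ → reachable-refl (avoid z) a (reachable⇒source∈A (avoid z) a ab)) grow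

  Dominating : (Fin n → Bool) → Fin n → Fin n → Set
  Dominating K x y = ∀ {z} → T (K z) → ¬ T (C[ z ] x y)

  record DominatingPair (K : Fin n → Bool) : Set where
    field
      x y        : Fin n
      x∈K        : T (K x)
      y∈K        : T (K y)
      dominating : Dominating K x y

  potential : Fin n → Fin n → ℕ
  potential x y = count (C[ y ] x) ⊕ count (C[ x ] y)

  potential≤ : ∀ x y → potential x y ≤ n ⊕ n
  potential≤ x y = ⊕-mono-≤ (count≤n (C[ y ] x)) (count≤n (C[ x ] y))

  module _ (K : Fin n → Bool) where

    -- A vertex z ∈ K with y ∈ C[ z ] x replaces y or x; by AT-freeness one of the two raises the potential.
    improve : ∀ fuel {x y} → T (K x) → T (K y) → n ⊕ n < potential x y + fuel → DominatingPair K
    improve zero {x} {y} _ _ bound = ⊥-elim (<⇒≱ (subst (n ⊕ n <_) (+-identityʳ _) bound) (potential≤ x y))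
    improve (suc fuel) {x} {y} x∈K y∈K bound with any? (λ z → T? (K z ∧ C[ z ] x y))
    ... | no none =
      record { x∈K = x∈K ; y∈K = y∈K ; dominating = λ {z} z∈K xy → none (z , from T-∧ (z∈K , xy)) }
    ... | yes (z , z∈K∧xy) with to (T-∧ {K z}) z∈K∧xy
    ...   | z∈K , xy with T? (C[ y ] x z)
    ...     | no ¬xz = improve fuel x∈K z∈K
                         (m<n+1+o⇒n<p⇒m<p+o bound (⊕-<ˡ _ (C-⊂ xy ¬xz) (s≤s (count≤n (C[ x ] y)))))
    ...     | yes xz = improve fuel z∈K y∈K
                         (m<n+1+o⇒n<p⇒m<p+o bound
                           (⊕-<ʳ (count-mono (λ {w} → C-⊆ xz {w})) (C-⊂ (reachable-sym xy) (¬asteroidal xy xz))))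

    -- Abstract, so that type checking never evaluates the search.
    abstract
      dominatingPair : ∀ {r} → T (K r) → DominatingPair K
      dominatingPair {r} r∈K = improve (suc (n ⊕ n)) r∈K r∈K (m≤n+m (suc (n ⊕ n)) (potential r r))

module Spine {n : ℕ} (G : Graph n) (atf : ATFree G) (r : Fin n) where
  open Reachability G
  open Domination G atf
  open DominatingPair (dominatingPair (component r) (component-refl {r}))

  K : Fin n → Bool
  K = component r

  everything : Fin n → Bool
  everything _ = true

  K⇒component-x : ∀ {w} → T (K w) → T (component x w)
  K⇒component-x = reachable-trans (reachable-sym x∈K)

  reached-within : Fin n → ℕ → Bool
  reached-within w k = reach everything x k w

  distance : Fin n → ℕ
  distance w = least (reached-within w) n

  distance-reach : ∀ {w} → T (component x w) → T (reach everything x (distance w) w)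
  distance-reach {w} = least-satisfies (reached-within w) n ≤-refl

  distance≤ : ∀ {k w} → T (reach everything x k w) → distance w ≤ k
  distance≤ {w = w} = least≤ (reached-within w) n

  distance-N[] : ∀ {u w} → T (component x u) → T (N[ u ] w) → distance w ≤ suc (distance u)
  distance-N[] {u} xu hit with N[]-sound hit
  ... | inj₁ refl = n≤1+n _
  ... | inj₂ u~w  = distance≤ (expand-intro {everything} {reach everything x (distance u)} (distance-reach xu) _ u~w)

  distance≡0 : ∀ {w} → T (component x w) → distance w ≡ 0 → w ≡ x
  distance≡0 {w} xw d≡0 =
    proj₂ (reach-zero everything x (subst (λ k → T (reach everything x k w)) d≡0 (distance-reach xw)))

  closer-neighbour : ∀ {w k} → T (component x w) → distance w ≡ suc k → ∃[ u ] Adj G u w × distance u ≡ k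
  closer-neighbour {w} {k} xw dw≡1+k
    with reach-parent everything x k (subst (λ j → T (reach everything x j w)) dw≡1+k (distance-reach xw))
                                     (least-minimal (reached-within w) n (subst (k <_) (sym dw≡1+k) (n<1+n k)))
  ... | u , ru , u~w = u , u~w , ≤-antisym (distance≤ ru) (≤-pred (subst (_≤ suc (distance u)) dw≡1+k dw≤))
    where
      dw≤ : distance w ≤ suc (distance u)
      dw≤ = distance-N[] (reach⊆reachable everything x k ru) (N[]-adj u~w)

  parent : Fin n → Fin n
  parent w = choose (λ u → (distance u ≡ᵇ pred (distance w)) ∧ adj G u w) w

  parent-spec : ∀ {w k} → T (component x w) → distance w ≡ suc k → Adj G (parent w) w × distance (parent w) ≡ k
  parent-spec {w} {k} xw dw≡1+k = proj₂ chosen , trans (≡ᵇ⇒≡ _ _ (proj₁ chosen)) (cong pred dw≡1+k)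
    where
      closer : ∃[ u ] Adj G u w × distance u ≡ k
      closer = closer-neighbour xw dw≡1+k
      chosen : T (distance (parent w) ≡ᵇ pred (distance w)) × Adj G (parent w) w
      chosen = to T-∧ (choose-satisfies (λ u → (distance u ≡ᵇ pred (distance w)) ∧ adj G u w)
                        (from T-∧ ( ≡⇒≡ᵇ _ _ (trans (proj₂ (proj₂ closer)) (cong pred (sym dw≡1+k)))
                                  , proj₁ (proj₂ closer) )))

  len : ℕ
  len = distance y

  ancestor : ℕ → Fin n
  ancestor zero    = y
  ancestor (suc j) = parent (ancestor j)

  ancestor-spec : ∀ {j} → j ≤ len → T (component x (ancestor j)) × distance (ancestor j) ≡ len ∸ j
  ancestor-spec {zero}  _      = K⇒component-x y∈K , refl
  ancestor-spec {suc j} j<len = component-step (proj₁ ih) (Adj-sym (proj₁ up)) , proj₂ up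
    where
      ih : T (component x (ancestor j)) × distance (ancestor j) ≡ len ∸ j
      ih = ancestor-spec (<⇒≤ j<len)
      up : Adj G (ancestor (suc j)) (ancestor j) × distance (ancestor (suc j)) ≡ len ∸ suc j
      up = parent-spec (proj₁ ih) (trans (proj₂ ih) (n<m⇒m∸n≡1+m∸1+n j<len))

  -- A shortest x–y path, read off backwards from y; beyond len it stays at y.
  spine : ℕ → Fin n
  spine i = ancestor (len ∸ i)

  spine-component : ∀ i → T (component x (spine i))
  spine-component i = proj₁ (ancestor-spec (m∸n≤m len i))

  spine-distance : ∀ {i} → i ≤ len → distance (spine i) ≡ i
  spine-distance {i} i≤len = trans (proj₂ (ancestor-spec (m∸n≤m len i))) (m∸[m∸n]≡n i≤len)

  spine-start : spine 0 ≡ x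
  spine-start = distance≡0 (spine-component 0) (spine-distance z≤n)

  spine-end : spine len ≡ y
  spine-end = cong ancestor (n∸n≡0 len)

  spine-adj : ∀ {i} → i < len → Adj G (spine i) (spine (suc i))
  spine-adj {i} i<len = subst (λ a → Adj G (ancestor a) (spine (suc i))) (sym (n<m⇒m∸n≡1+m∸1+n i<len))
                          (proj₁ (parent-spec (spine-component (suc i)) (spine-distance i<len)))

  spine-chain : ∀ i → T (N[ spine i ] (spine (suc i)))
  spine-chain i = [ stays , N[]-adj ∘ spine-adj ]′ (≤-<-connex len i)
    where
      stays : len ≤ i → T (N[ spine i ] (spine (suc i)))
      stays len≤i = subst (λ a → T (N[ spine i ] (ancestor a)))
                          (trans (m≤n⇒m∸n≡0 len≤i) (sym (m≤n⇒m∸n≡0 (m≤n⇒m≤1+n len≤i)))) N[]-refl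

  spine-reaches : ∀ {w} → (∀ {j} → j ≤ len → ¬ T (N[ spine j ] w)) → T (C[ w ] x y)
  spine-reaches {w} misses = subst (T ∘ C[ w ] x) spine-end (go len ≤-refl)
    where
      avoids : ∀ {j} → j ≤ len → T (not (N[ w ] (spine j)))
      avoids j≤len = T-not⁺ (misses j≤len ∘ N[]-sym)
      go : ∀ i → i ≤ len → T (C[ w ] x (spine i))
      go zero    _     = subst (T ∘ C[ w ] x) (sym spine-start)
                           (reachable-refl _ x (subst (T ∘ not ∘ N[ w ]) spine-start (avoids z≤n)))
      go (suc i) i<len = reachable-step _ x (go i (<⇒≤ i<len)) (avoids i<len) (spine-adj i<len)

  touches : Fin n → ℕ → Bool
  touches w j = N[ spine j ] w

  entry exit : Fin n → ℕ
  entry w = least (touches w) len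
  exit  w = greatest (touches w) len

  entry≤len : ∀ w → entry w ≤ len
  entry≤len w = least≤bound (touches w) len

  exit≤len : ∀ w → exit w ≤ len
  exit≤len w = greatest≤bound (touches w) len

  before-entry : ∀ w {j} → j < entry w → ¬ T (N[ spine j ] w)
  before-entry w = least-minimal (touches w) len

  after-exit : ∀ w {j} → exit w < j → j ≤ len → ¬ T (N[ spine j ] w)
  after-exit w = greatest-maximal (touches w) len

  entry-touches : ∀ {w} → T (K w) → T (N[ spine (entry w) ] w)
  entry-touches {w} w∈K = decidable-stable (T? _) λ miss →
    dominating w∈K (spine-reaches (λ j≤len hit → miss (least-satisfies (touches w) len j≤len hit)))

  exit-touches : ∀ {w} → T (K w) → T (N[ spine (exit w) ] w)
  exit-touches {w} w∈K = greatest-satisfies (touches w) len (entry≤len w) (entry-touches w∈K)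

  entry≤exit : ∀ {w} → T (K w) → entry w ≤ exit w
  entry≤exit {w} w∈K = least≤ (touches w) len (exit-touches w∈K)

  touch-distance : ∀ {i w} → i ≤ len → T (K w) → T (N[ spine i ] w) → distance w ≤ suc i × i ≤ suc (distance w)
  touch-distance {i} {w} i≤len w∈K hit =
      subst (λ d → distance w ≤ suc d) (spine-distance i≤len) (distance-N[] (spine-component i) hit)
    , subst (_≤ suc (distance w)) (spine-distance i≤len) (distance-N[] (K⇒component-x w∈K) (N[]-sym hit))

  spine∈K : ∀ i → T (K (spine i))
  spine∈K i = reachable-trans x∈K (spine-component i)

  spine-far : ∀ {i j} → 2 + i ≤ j → j ≤ len → ¬ T (N[ spine i ] (spine j))
  spine-far {i} {j} 2+i≤j j≤len hit =
    <⇒≱ 2+i≤j (subst (_≤ suc i) (spine-distance j≤len) (proj₁ (touch-distance i≤len (spine∈K j) hit)))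
    where
      i≤len : i ≤ len
      i≤len = ≤-trans (m≤n+m i 2) (≤-trans 2+i≤j j≤len)

  exit≤2+entry : ∀ {w} → T (K w) → exit w ≤ 2 + entry w
  exit≤2+entry {w} w∈K =
    ≤-trans (proj₂ (touch-distance (exit≤len w) w∈K (exit-touches w∈K)))
            (s≤s (proj₁ (touch-distance (entry≤len w) w∈K (entry-touches w∈K))))

  exit≤3+entry : ∀ {u v} → T (K u) → Adj G u v → exit v ≤ 3 + entry u
  exit≤3+entry {u} {v} u∈K u~v =
    ≤-trans (proj₂ (touch-distance (exit≤len v) v∈K (exit-touches v∈K)))
            (s≤s (≤-trans (distance-N[] (K⇒component-x u∈K) (N[]-adj u~v))
                          (s≤s (proj₁ (touch-distance (entry≤len u) u∈K (entry-touches u∈K))))))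
    where
      v∈K : T (K v)
      v∈K = component-step u∈K u~v

  -- Otherwise u, spine (1 + exit u) and spine (3 + exit u) would form an asteroidal triple.
  entry≤2+exit : ∀ {u v} → T (K u) → Adj G u v → entry v ≤ 2 + exit u
  entry≤2+exit {u} {v} u∈K u~v = ≮⇒≥ far⇒asteroidal
    where
      far⇒asteroidal : ¬ (2 + exit u < entry v)
      far⇒asteroidal far = atf u (spine (1 + c)) (spine (3 + c)) (asteroidal via-spine-c via-spine via-v)
        where
          c : ℕ
          c = exit u
          v∈K : T (K v)
          v∈K = component-step u∈K u~v
          entry-v : entry v ≡ 3 + c
          entry-v = ≤-antisym (≤-trans (entry≤exit v∈K) (≤-trans (exit≤3+entry u∈K u~v) (+-monoʳ-≤ 3 (entry≤exit u∈K))))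
                              far
          3+c≤len : 3 + c ≤ len
          3+c≤len = subst (_≤ len) entry-v (entry≤len v)
          u∉N[spine_] : ∀ {j} → c < j → j ≤ len → ¬ T (N[ spine j ] u)
          u∉N[spine_] = after-exit u
          spine∉N[u] : ∀ {j} → c < j → j ≤ len → ¬ T (N[ u ] (spine j))
          spine∉N[u] c<j j≤len = u∉N[spine_] c<j j≤len ∘ N[]-sym
          u~spine-c : Adj G u (spine c)
          u~spine-c = Adj-sym (N[]⇒Adj (exit-touches u∈K) λ u≡spine-c →
                        before-entry v (subst (c <_) (sym entry-v) (m<n+m c z<s))
                                       (N[]-adj (subst (λ a → Adj G a v) u≡spine-c u~v)))
          v~spine-3+c : Adj G v (spine (3 + c))
          v~spine-3+c = Adj-sym (N[]⇒Adj (subst (λ j → T (N[ spine j ] v)) entry-v (entry-touches v∈K))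
                          λ v≡spine-3+c → u∉N[spine_] (m<n+m c z<s) 3+c≤len
                                            (N[]-adj (Adj-sym (subst (Adj G u) v≡spine-3+c u~v))))
          via-spine-c : PathAvoiding G u (spine (1 + c)) (spine (3 + c))
          via-spine-c = path₃ u~spine-c (spine-adj (≤-trans (n≤1+n _) (≤-trans (n≤1+n _) 3+c≤len)))
                          (u∉N[spine_] (m<n+m c z<s) 3+c≤len)
                          (spine-far (n≤1+n _) 3+c≤len ∘ N[]-sym)
                          (spine-far ≤-refl 3+c≤len ∘ N[]-sym)
          via-spine : PathAvoiding G (spine (1 + c)) (spine (3 + c)) u
          via-spine = path₃ (spine-adj (≤-trans (n≤1+n _) 3+c≤len)) (spine-adj 3+c≤len)
                        (spine∉N[u] (n<1+n c) (≤-trans (n≤1+n _) (≤-trans (n≤1+n _) 3+c≤len)))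
                        (spine∉N[u] (m<n+m c z<s) (≤-trans (n≤1+n _) 3+c≤len))
                        (spine∉N[u] (m<n+m c z<s) 3+c≤len)
          via-v : PathAvoiding G u (spine (3 + c)) (spine (1 + c))
          via-v = path₃ u~v v~spine-3+c
                    (u∉N[spine_] (n<1+n c) (≤-trans (n≤1+n _) (≤-trans (n≤1+n _) 3+c≤len)))
                    (before-entry v (subst (1 + c <_) (sym entry-v) (n≤1+n (2 + c))))
                    (spine-far ≤-refl 3+c≤len)

  window : ℕ → Fin n → Bool
  window b w = N[ spine b ] w ∨ N[ spine (1 + b) ] w ∨ N[ spine (2 + b) ] w

  ∈window : ∀ {b j w} → b ≤ j → j ≤ 2 + b → T (N[ spine j ] w) → T (window b w)
  ∈window {b} {j} {w} b≤j j≤2+b hit with within-two b≤j j≤2+b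
  ... | inj₁ refl          = from (T-∨ {N[ spine b ] w}) (inj₁ hit)
  ... | inj₂ (inj₁ refl) = from (T-∨ {N[ spine b ] w}) (inj₂ (from (T-∨ {N[ spine (1 + b) ] w}) (inj₁ hit)))
  ... | inj₂ (inj₂ refl) = from (T-∨ {N[ spine b ] w}) (inj₂ (from (T-∨ {N[ spine (1 + b) ] w}) (inj₂ hit)))

  -- Consecutive spine vertices are equal or adjacent, so the window lies in N[spine b] ∪ N(spine (1+b)) ∪ N(spine (2+b)).
  count-window : ∀ b → count (window b) ≤ suc (3 * maxDegree G)
  count-window b = begin
    count (window b)                                       ≤⟨ count-mono {f = window b} {g = cover-set} (λ {w} → cover {w}) ⟩
    count cover-set                                        ≤⟨ count-∨ N[ p₀ ] _ ⟩
    count N[ p₀ ] + count (λ w → adj G p₁ w ∨ adj G p₂ w) ≤⟨ +-mono-≤ (count-N[]≤ p₀) (count-∨ (adj G p₁) (adj G p₂)) ⟩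
    suc Δ + (count (adj G p₁) + count (adj G p₂))          ≤⟨ +-monoʳ-≤ (suc Δ) (+-mono-≤ (degree≤ p₁) (degree≤ p₂)) ⟩
    suc Δ + (Δ + Δ)                                        ≡⟨ cong (λ d → suc (Δ + (Δ + d))) (sym (+-identityʳ Δ)) ⟩
    suc (3 * Δ)                                            ∎
    where
      open ≤-Reasoning
      Δ : ℕ
      Δ = maxDegree G
      p₀ p₁ p₂ : Fin n
      p₀ = spine b
      p₁ = spine (1 + b)
      p₂ = spine (2 + b)
      degree≤ : ∀ v → count (adj G v) ≤ Δ
      degree≤ = count-adj≤maxDegree G
      cover-set : Fin n → Bool
      cover-set w = N[ p₀ ] w ∨ (adj G p₁ w ∨ adj G p₂ w)
      cover : window b ⊆ cover-set
      cover {w} h = from (T-∨ {N[ p₀ ] w}) (map₂ (from (T-∨ {adj G p₁ w}))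
                      ([ inj₁ , [ via-p₁ , via-p₂ ]′ ∘ to (T-∨ {N[ p₁ ] w}) ]′ (to (T-∨ {N[ p₀ ] w}) h)))
        where
          via-p₁ : T (N[ p₁ ] w) → T (N[ p₀ ] w) ⊎ Adj G p₁ w ⊎ Adj G p₂ w
          via-p₁ = map₂ inj₁ ∘ N[]-shift (spine-chain b)
          via-p₂ : T (N[ p₂ ] w) → T (N[ p₀ ] w) ⊎ Adj G p₁ w ⊎ Adj G p₂ w
          via-p₂ = [ via-p₁ , inj₂ ∘ inj₂ ]′ ∘ N[]-shift (spine-chain (1 + b))

  len≤n : len ≤ n
  len≤n = least≤bound (reached-within y) n

  infix 4 _≼_
  _≼_ : Fin n → Fin n → Set
  u ≼ w = entry u ≤ entry w × (entry u ≡ entry w → exit u ≤ exit w)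

  Between : Fin n → Fin n → Fin n → Set
  Between u w v = u ≼ w × entry w ≤ entry v

  WindowContains : ℕ → Fin n → Fin n → Set
  WindowContains b u v = ∀ {w} → T (K w) → Between u w v → T (window b w)

  window-covers : ∀ {u v} → T (K u) → Adj G u v → entry u ≤ entry v →
                  ∃[ b ] T (window b v) × WindowContains b u v
  window-covers {u} {v} u∈K u~v eu≤ev = [ near , far ]′ (≤-<-connex (entry v) (2 + entry u))
    where
      v∈K : T (K v)
      v∈K = component-step u∈K u~v
      near : entry v ≤ 2 + entry u → ∃[ b ] T (window b v) × WindowContains b u v
      near ev≤2+eu = entry u , ∈window eu≤ev ev≤2+eu (entry-touches v∈K) ,
                     λ { w∈K ((eu≤ew , _) , ew≤ev) → ∈window eu≤ew (≤-trans ew≤ev ev≤2+eu) (entry-touches w∈K) }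
      far : 2 + entry u < entry v → ∃[ b ] T (window b v) × WindowContains b u v
      far 2+eu<ev =
        1 + entry u , ∈window (≤-trans (m≤n+m (1 + entry u) 2) 2+eu<ev) (≤-reflexive ev≡3+eu) (entry-touches v∈K) , covers
        where
          ev≡3+eu : entry v ≡ 3 + entry u
          ev≡3+eu = ≤-antisym (≤-trans (entry≤exit v∈K) (exit≤3+entry u∈K u~v)) 2+eu<ev
          1+eu≤xu : 1 + entry u ≤ exit u
          1+eu≤xu = ≤-pred (≤-pred (subst (_≤ 2 + exit u) ev≡3+eu (entry≤2+exit u∈K u~v)))
          covers : WindowContains (1 + entry u) u v
          covers {w} w∈K ((eu≤ew , same-entry) , ew≤ev) = [ later , same ]′ (m≤n⇒m<n∨m≡n eu≤ew)
            where
              later : entry u < entry w → T (window (1 + entry u) w)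
              later eu<ew = ∈window eu<ew (≤-trans ew≤ev (≤-reflexive ev≡3+eu)) (entry-touches w∈K)
              same : entry u ≡ entry w → T (window (1 + entry u) w)
              same eu≡ew = ∈window (≤-trans 1+eu≤xu (same-entry eu≡ew))
                                     (≤-trans (exit≤2+entry w∈K)
                                              (≤-trans (≤-reflexive (cong (2 +_) (sym eu≡ew))) (n≤1+n (2 + entry u))))
                                     (exit-touches w∈K)

module Layout {n : ℕ} (G : Graph n) (atf : ATFree G) where
  open Reachability G
  open Digits (suc n)
  module S = Spine G atf

  rep : Fin n → Fin n
  rep w = choose (component w) w

  rep-component : ∀ w → T (component (rep w) w)
  rep-component w = reachable-sym (choose-satisfies (component w) (component-refl {w}))

  rep-adj : ∀ {u v} → Adj G u v → rep u ≡ rep v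
  rep-adj {u} {v} u~v = choose-cong (λ i → T-ext (reachable-trans v→u) (reachable-trans u→v)) (component-refl {u})
    where
      u→v : T (component u v)
      u→v = component-step component-refl u~v
      v→u : T (component v u)
      v→u = component-step component-refl (Adj-sym u~v)

  -- Vertices are ordered by component, then by where the component's spine enters and leaves N[w].
  keyIn : Fin n → Fin n → ℕ
  keyIn r w = toℕ r ⊕ S.entry r w ⊕ S.exit r w ⊕ toℕ w

  key : Fin n → ℕ
  key w = keyIn (rep w) w

  entry<B : ∀ r w → S.entry r w < suc n
  entry<B r w = s≤s (≤-trans (S.entry≤len r w) (S.len≤n r))

  exit<B : ∀ r w → S.exit r w < suc n
  exit<B r w = s≤s (≤-trans (S.exit≤len r w) (S.len≤n r))

  toℕ<B : ∀ w → toℕ w < suc n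
  toℕ<B w = m≤n⇒m≤1+n (toℕ<n w)

  key-≤⇒rep-≤ : ∀ {u w} → key u ≤ key w → toℕ (rep u) ≤ toℕ (rep w)
  key-≤⇒rep-≤ {u} {w} = ⊕-≤⇒≤ˡ (entry<B (rep w) w) ∘ ⊕-≤⇒≤ˡ (exit<B (rep w) w) ∘ ⊕-≤⇒≤ˡ (toℕ<B w)

  keyIn-≤ : ∀ r {u w} → keyIn r u ≤ keyIn r w → S._≼_ r u w
  keyIn-≤ r {u} {w} u≤w =
    ⊕-≤⇒≤ʳ entry-level , λ same → ⊕-≤⇒≤ʳ (subst (λ e → toℕ r ⊕ e ⊕ _ ≤ _) same exit-level)
    where
      exit-level : toℕ r ⊕ S.entry r u ⊕ S.exit r u ≤ toℕ r ⊕ S.entry r w ⊕ S.exit r w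
      exit-level = ⊕-≤⇒≤ˡ (toℕ<B w) u≤w
      entry-level : toℕ r ⊕ S.entry r u ≤ toℕ r ⊕ S.entry r w
      entry-level = ⊕-≤⇒≤ˡ (exit<B r w) exit-level

  key-injective : ∀ {u v} → key u ≡ key v → u ≡ v
  key-injective {u} {v} = toℕ-injective ∘ ⊕-injectiveʳ (toℕ<B u) (toℕ<B v)

  key-between : ∀ {u v w} → rep v ≡ rep u → key u ≤ key w → key w ≤ key v →
                rep w ≡ rep u × S.Between (rep u) u w v
  key-between {u} {v} {w} rv≡ru ku≤kw kw≤kv = rw≡ru , lower , proj₁ upper
    where
      rw≡ru : rep w ≡ rep u
      rw≡ru = toℕ-injective (≤-antisym (subst (λ r → toℕ (rep w) ≤ toℕ r) rv≡ru (key-≤⇒rep-≤ kw≤kv))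
                                       (key-≤⇒rep-≤ ku≤kw))
      key-w : key w ≡ keyIn (rep u) w
      key-w = cong (λ r → keyIn r w) rw≡ru
      key-v : key v ≡ keyIn (rep u) v
      key-v = cong (λ r → keyIn r v) rv≡ru
      lower : S._≼_ (rep u) u w
      lower = keyIn-≤ (rep u) (subst (key u ≤_) key-w ku≤kw)
      upper : S._≼_ (rep u) w v
      upper = keyIn-≤ (rep u) (subst₂ _≤_ key-w key-v kw≤kv)

  open Ranking key key-injective public

  count-between : ∀ {u v} → Adj G u v → key u < key v → count (between u v) ≤ 3 * maxDegree G
  count-between {u} {v} u~v ku<kv = ≤-pred (begin-strict
    count (between u v)   <⟨ count-mono-< {f = between u v} {g = S.window r b} (λ {w} → covered {w}) v v∈window v∉between ⟩
    count (S.window r b)  ≤⟨ S.count-window r b ⟩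
    suc (3 * maxDegree G) ∎)
    where
      open ≤-Reasoning
      r : Fin n
      r = rep u
      rv≡r : rep v ≡ r
      rv≡r = sym (rep-adj u~v)
      entry-uv : S.entry r u ≤ S.entry r v
      entry-uv = proj₁ (proj₁ (proj₂ (key-between rv≡r (<⇒≤ ku<kv) ≤-refl)))
      cover : ∃[ b ] T (S.window r b v) × S.WindowContains r b u v
      cover = S.window-covers r (rep-component u) u~v entry-uv
      b : ℕ
      b = proj₁ cover
      v∈window : T (S.window r b v)
      v∈window = proj₁ (proj₂ cover)
      v∉between : ¬ T (between u v v)
      v∉between h = <-irrefl refl (<ᵇ⇒< (key v) (key v) (proj₂ (to (T-∧ {key u ≤ᵇ key v}) h)))
      covered : ∀ {w} → T (between u v w) → T (S.window r b w)
      covered {w} h = proj₂ (proj₂ cover) (subst (λ r′ → T (component r′ w)) (proj₁ w-between) (rep-component w))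
                                          (proj₂ w-between)
        where
          bounds : T (key u ≤ᵇ key w) × T (key w <ᵇ key v)
          bounds = to (T-∧ {key u ≤ᵇ key w}) h
          w-between : rep w ≡ r × S.Between r u w v
          w-between = key-between rv≡r (≤ᵇ⇒≤ (key u) (key w) (proj₁ bounds))
                                       (<⇒≤ (<ᵇ⇒< (key w) (key v) (proj₂ bounds)))

  ordering-width : WidthAtMost G ordering (3 * maxDegree G)
  ordering-width u v u~v =
    subst₂ (λ a b → dist a b ≤ 3 * maxDegree G) (sym (toℕ-ordering u)) (sym (toℕ-ordering v))
           (ranks-close (λ { refl → Adj-irrefl u~v }) (count-between u~v) (count-between (Adj-sym u~v)))

lemma8 : ∀ {n : ℕ} (G : Graph n) → ATFree G → BandwidthAtMost G (3 * maxDegree G)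
lemma8 G atf = ordering , ordering-width
  where open Layout G atf
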